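{- For all sequences of bins $\sigma$ and all integers $0\le s'\le s$ and $0\le \ell'\le \ell$, $\mathrm{OPT}(\sigma,s',\ell')\le \mathrm{OPT}(\sigma,s,\ell)$.
   Context: Restricted Grid Scheduling setting: $S>1$ is an integer, $L=2S-1$, $M=4S-3$; bins have integer sizes in $[S,M]$ and $\sigma$ contains enough bins for all items to be packed. A packing is valid if each empty bin is smaller than every item packed in a later bin; its cost is the sum of sizes of bins receiving at least one item. $\mathrm{OPT}(\sigma,s,\ell)$ denotes the minimum cost of a valid packing of $s$ items of size $S$ and $\ell$ items of size $L$ into $\sigma$. -}

module Defs where

open import Data.Nat using (ℕ; zero; suc; _+_; _*_; _∸_; _≤_; _<_)
open import Data.List using (List; []; _∷_; map)
open import Data.Nat.ListAction using (sum)
open import Data.List.Relation.Unary.All using (All)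
open import Data.Product using (Σ; _×_; _,_; proj₁)
open import Data.Unit using (⊤)
open import Relation.Binary.PropositionalEquality using (_≡_)

-- Restricted Grid Scheduling with parameter S (S > 1):
-- small items have size S, large items have size L = 2S-1,
-- bins have sizes in [S, M] with M = 4S-3.
Lsz : ℕ → ℕ
Lsz S = 2 * S ∸ 1

Msz : ℕ → ℕ
Msz S = 4 * S ∸ 3

BinSeq : Set
BinSeq = List ℕ

BinsInRange : ℕ → BinSeq → Set
BinsInRange S σ = All (λ b → S ≤ b × b ≤ Msz S) σ

record Slot : Set where
  constructor slot
  field
    size   : ℕ
    nSmall : ℕ
    nLarge : ℕ
open Slot public

Packing : Set
Packing = List Slot

OnBins : Packing → BinSeq → Set
OnBins p σ = map size p ≡ σ

Empty : Slot → Set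
Empty x = (nSmall x ≡ 0) × (nLarge x ≡ 0)

usedSize : Slot → ℕ
usedSize (slot b zero zero) = 0
usedSize (slot b _ _)       = b

Fits : ℕ → Slot → Set
Fits S x = nSmall x * S + nLarge x * Lsz S ≤ size x

SmallerThanItemsOf : ℕ → Slot → Slot → Set
SmallerThanItemsOf S x y =
  (0 < nSmall y → size x < S) × (0 < nLarge y → size x < Lsz S)

EmptyCond : ℕ → Packing → Set
EmptyCond S []       = ⊤
EmptyCond S (x ∷ xs) =
  (Empty x → All (SmallerThanItemsOf S x) xs) × EmptyCond S xs

ValidPacking : ℕ → BinSeq → ℕ → ℕ → Packing → Set
ValidPacking S σ s ℓ p =
  OnBins p σ ×
  All (Fits S) p ×
  sum (map nSmall p) ≡ s ×
  sum (map nLarge p) ≡ ℓ ×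
  EmptyCond S p

cost : Packing → ℕ
cost p = sum (map usedSize p)

IsOPT : ℕ → BinSeq → ℕ → ℕ → ℕ → Set
IsOPT S σ s ℓ c =
  (Σ Packing λ p → ValidPacking S σ s ℓ p × cost p ≡ c) ×
  (∀ p → ValidPacking S σ s ℓ p → c ≤ cost p)

-- Deleting one item cannot increase the optimum. Delete it from the last bin containing an item of its
-- kind. Whether an empty bin may precede some bins depends only on which kinds of items they contain, and
-- after the deletion no kind of item follows a bin unless it did before; so the only possible violation is
-- that the bin just emptied is followed by an item of the other kind that is not larger than it. That item then
-- fits into the bin: move one such item there, which keeps the bin's cost, and delete it from the later
-- bins by the same procedure. The optimum for fewer items exists because only finitely many packings
-- put at most s small and ℓ large items into each bin of σ.
module Submission where

open import Defs
open import Data.Nat using (ℕ; zero; suc; pred; z<s; _+_; _*_; _≤_; _<_; _≤′_; ≤′-reflexive; ≤′-step; z≤n; s≤s)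
open import Data.Nat.Properties
open import Data.Nat.ListAction using (sum)
open import Data.List using (List; []; _∷_; map; filter; upTo; cartesianProductWith)
open import Data.List.Properties using (≡-dec)
open import Data.List.Relation.Unary.All as All using (All; []; _∷_; all?)
open import Data.List.Relation.Unary.All.Properties using (all-filter; map⁻)
open import Data.List.Membership.Propositional using (_∈_)
open import Data.List.Membership.Propositional.Properties
  using (∈-cartesianProductWith⁺; ∈-upTo⁺; ∈-filter⁺)
open import Data.List.Extrema ≤-totalOrder using (argmin; argmin-all; f[argmin]≤f[xs])
open import Data.List.Relation.Unary.Any using (here)
open import Data.Product using (Σ; _×_; _,_; proj₁; proj₂)
open import Data.Sum using (_⊎_; inj₁; inj₂)
open import Data.Unit using (tt)
open import Data.Empty using (⊥-elim)
open import Relation.Nullary using (Dec; yes; no; ¬_)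
open import Relation.Nullary.Decidable using (_×-dec_; _→-dec_)
open import Relation.Binary.PropositionalEquality

data Kind : Set where
  small large : Kind

other : Kind → Kind
other small = large
other large = small

other-involutive : ∀ k → other (other k) ≡ k
other-involutive small = refl
other-involutive large = refl

kind-cases : ∀ k k′ → k′ ≡ k ⊎ k′ ≡ other k
kind-cases small small = inj₁ refl
kind-cases small large = inj₂ refl
kind-cases large small = inj₂ refl
kind-cases large large = inj₁ refl

itemSize : ℕ → Kind → ℕ
itemSize S small = S
itemSize S large = Lsz S

count : Kind → Slot → ℕ
count small = nSmall
count large = nLarge

total : Kind → Packing → ℕ
total k p = sum (map (count k) p)

dropItem : Kind → Slot → Slot
dropItem small (slot b i j) = slot b (pred i) j
dropItem large (slot b i j) = slot b i (pred j)

singleItem : ℕ → Kind → Slot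
singleItem b small = slot b 1 0
singleItem b large = slot b 0 1

empty? : ∀ x → Dec (Empty x)
empty? x = (nSmall x ≟ 0) ×-dec (nLarge x ≟ 0)

Empty⇒count≡0 : ∀ k {x} → Empty x → count k x ≡ 0
Empty⇒count≡0 small = proj₁
Empty⇒count≡0 large = proj₂

size-dropItem : ∀ k x → size (dropItem k x) ≡ size x
size-dropItem small x = refl
size-dropItem large x = refl

count-dropItem : ∀ k x → count k (dropItem k x) ≡ pred (count k x)
count-dropItem small x = refl
count-dropItem large x = refl

count-other-dropItem : ∀ k x → count (other k) (dropItem k x) ≡ count (other k) x
count-other-dropItem small x = refl
count-other-dropItem large x = refl

count-singleItem : ∀ b k → count k (singleItem b k) ≡ 1
count-singleItem b small = refl
count-singleItem b large = refl

count-singleItem-other : ∀ b k → count k (singleItem b (other k)) ≡ 0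
count-singleItem-other b small = refl
count-singleItem-other b large = refl

size-singleItem : ∀ b k → size (singleItem b k) ≡ b
size-singleItem b small = refl
size-singleItem b large = refl

singleItem-nonempty : ∀ b k → ¬ Empty (singleItem b k)
singleItem-nonempty b small (() , _)
singleItem-nonempty b large (_ , ())

usedSize≤size : ∀ x → usedSize x ≤ size x
usedSize≤size (slot b zero zero)    = z≤n
usedSize≤size (slot b zero (suc j)) = ≤-refl
usedSize≤size (slot b (suc i) j)    = ≤-refl

usedSize-occupied : ∀ k {x} → 0 < count k x → usedSize x ≡ size x
usedSize-occupied small {slot b (suc i) j}    _ = refl
usedSize-occupied large {slot b zero (suc j)} _ = refl
usedSize-occupied large {slot b (suc i) (suc j)} _ = refl

usedSize-singleItem : ∀ b k → usedSize (singleItem b k) ≡ b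
usedSize-singleItem b small = refl
usedSize-singleItem b large = refl

Fits-dropItem : ∀ {S} k x → Fits S x → Fits S (dropItem k x)
Fits-dropItem {S} small (slot b i j) = ≤-trans (+-monoˡ-≤ (j * Lsz S) (*-monoˡ-≤ S (pred[n]≤n {i})))
Fits-dropItem {S} large (slot b i j) = ≤-trans (+-monoʳ-≤ (i * S) (*-monoˡ-≤ (Lsz S) (pred[n]≤n {j})))

Fits-singleItem : ∀ {S b} k → itemSize S k ≤ b → Fits S (singleItem b k)
Fits-singleItem {S} small = ≤-trans (≤-reflexive (trans (+-identityʳ _) (+-identityʳ S)))
Fits-singleItem {S} large = ≤-trans (≤-reflexive (+-identityʳ (Lsz S)))

SmallerThanItems : ℕ → Slot → Packing → Set
SmallerThanItems S x ys = ∀ k → 0 < total k ys → size x < itemSize S k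

module _ (S : ℕ) (x : Slot) where

  smallerThanItemsOf⇒ : ∀ {y} → SmallerThanItemsOf S x y →
    ∀ k → 0 < count k y → size x < itemSize S k
  smallerThanItemsOf⇒ h small = proj₁ h
  smallerThanItemsOf⇒ h large = proj₂ h

  all-smallerThanItemsOf⇒ : ∀ ys → All (SmallerThanItemsOf S x) ys → SmallerThanItems S x ys
  all-smallerThanItemsOf⇒ (y ∷ ys) (h ∷ hs) k pos with count k y in occupied
  ... | zero  = all-smallerThanItemsOf⇒ ys hs k pos
  ... | suc _ = smallerThanItemsOf⇒ h k (subst (0 <_) (sym occupied) z<s)

  smallerThanItems⇒all : ∀ ys → SmallerThanItems S x ys → All (SmallerThanItemsOf S x) ys
  smallerThanItems⇒all []       h = []
  smallerThanItems⇒all (y ∷ ys) h =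
    ((λ pos → h small (≤-trans pos (m≤m+n _ _))) , (λ pos → h large (≤-trans pos (m≤m+n _ _))))
    ∷ smallerThanItems⇒all ys (λ k pos → h k (≤-trans pos (m≤n+m _ (count k y))))

  all-smallerThanItemsOf-mono : ∀ ys zs → (∀ k → total k zs ≤ total k ys) →
    All (SmallerThanItemsOf S x) ys → All (SmallerThanItemsOf S x) zs
  all-smallerThanItemsOf-mono ys zs zs≤ys h =
    smallerThanItems⇒all zs (λ k pos → all-smallerThanItemsOf⇒ ys h k (≤-trans pos (zs≤ys k)))

Admissible : ℕ → Packing → Set
Admissible S p = All (Fits S) p × EmptyCond S p

record Reduct (S : ℕ) (k : Kind) (n : ℕ) (p : Packing) : Set where
  field
    packing     : Packing
    sameBins    : map size packing ≡ map size p
    admissible  : Admissible S packing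
    total-kind  : total k packing ≡ n
    total-other : total (other k) packing ≡ total (other k) p
    cost≤       : cost packing ≤ cost p
open Reduct

Reduct-total≤ : ∀ {S k n p} (r : Reduct S k n p) → n ≤ total k p →
  ∀ k′ → total k′ (packing r) ≤ total k′ p
Reduct-total≤ {k = k} r n≤ k′ with kind-cases k k′
... | inj₁ refl = ≤-trans (≤-reflexive (total-kind r)) n≤
... | inj₂ refl = ≤-reflexive (total-other r)

usedSize-dropItem≤ : ∀ k x → 0 < count k x → usedSize (dropItem k x) ≤ usedSize x
usedSize-dropItem≤ k x occupied = begin
  usedSize (dropItem k x) ≤⟨ usedSize≤size (dropItem k x) ⟩
  size (dropItem k x)     ≡⟨ size-dropItem k x ⟩
  size x                  ≡⟨ usedSize-occupied k occupied ⟨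
  usedSize x              ∎
  where open ≤-Reasoning

dropFromHead : ∀ {S} k x xs {n} → Admissible S (x ∷ xs) → total k xs ≡ 0 → count k x ≡ suc n →
  (Empty (dropItem k x) → All (SmallerThanItemsOf S (dropItem k x)) xs) → Reduct S k n (x ∷ xs)
dropFromHead k x xs {n} (f ∷ fs , _ , es) none occupied emptied-ok = record
  { packing     = dropItem k x ∷ xs
  ; sameBins    = cong (_∷ map size xs) (size-dropItem k x)
  ; admissible  = Fits-dropItem k x f ∷ fs , emptied-ok , es
  ; total-kind  = trans (cong₂ _+_ (trans (count-dropItem k x) (cong pred occupied)) none) (+-identityʳ n)
  ; total-other = cong (_+ total (other k) xs) (count-other-dropItem k x)
  ; cost≤       = +-monoˡ-≤ (cost xs) (usedSize-dropItem≤ k x (subst (0 <_) (sym occupied) z<s))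
  }

dropItem-smallerThanItems : ∀ {S} k x xs → total k xs ≡ 0 →
  (0 < total (other k) xs → size x < itemSize S (other k)) →
  All (SmallerThanItemsOf S (dropItem k x)) xs
dropItem-smallerThanItems {S} k x xs none below = smallerThanItems⇒all S (dropItem k x) xs smaller
  where
  smaller : SmallerThanItems S (dropItem k x) xs
  smaller k′ pos with kind-cases k k′
  ... | inj₁ refl = ⊥-elim (n≮0 (subst (0 <_) none pos))
  ... | inj₂ refl = subst (_< _) (sym (size-dropItem k x)) (below pos)

mutual
  remove : ∀ {S} k p {n} → Admissible S p → total k p ≡ suc n → Reduct S k n p
  remove k (x ∷ xs) (f ∷ fs , e , es) eq with total k xs in tail≡
  ... | zero  = removeFromHead k x xs (f ∷ fs , e , es) tail≡ (trans (sym (+-identityʳ _)) eq)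
  ... | suc m = record
    { packing     = x ∷ packing r
    ; sameBins    = cong (size x ∷_) (sameBins r)
    ; admissible  = f ∷ proj₁ (admissible r) ,
                    (λ emp → all-smallerThanItemsOf-mono _ x xs (packing r) bound (e emp)) ,
                    proj₂ (admissible r)
    ; total-kind  = trans (cong (count k x +_) (total-kind r)) (suc-injective (trans (sym (+-suc _ m)) eq))
    ; total-other = cong (count (other k) x +_) (total-other r)
    ; cost≤       = +-monoʳ-≤ (usedSize x) (cost≤ r)
    }
    where
    r = remove k xs (fs , es) tail≡
    bound : ∀ k′ → total k′ (packing r) ≤ total k′ xs
    bound = Reduct-total≤ r (≤-trans (n≤1+n m) (≤-reflexive (sym tail≡)))

  removeFromHead : ∀ {S} k x xs {n} → Admissible S (x ∷ xs) → total k xs ≡ 0 → count k x ≡ suc n →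
    Reduct S k n (x ∷ xs)
  removeFromHead {S} k x xs adm none occupied with empty? (dropItem k x)
  ... | no nonempty = dropFromHead k x xs adm none occupied (λ e → ⊥-elim (nonempty e))
  ... | yes emptied with total (other k) xs in others | size x <? itemSize S (other k)
  ...   | zero  | _           = dropFromHead k x xs adm none occupied λ _ →
                                  dropItem-smallerThanItems k x xs none λ pos → ⊥-elim (n≮0 (subst (0 <_) others pos))
  ...   | suc m | yes below   = dropFromHead k x xs adm none occupied λ _ →
                                  dropItem-smallerThanItems k x xs none λ _ → below
  ...   | suc m | no notBelow = refillHead k x xs adm none occupied emptied others (≮⇒≥ notBelow)

  refillHead : ∀ {S} k x xs {n m} → Admissible S (x ∷ xs) → total k xs ≡ 0 → count k x ≡ suc n →
    Empty (dropItem k x) → total (other k) xs ≡ suc m → itemSize S (other k) ≤ size x →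
    Reduct S k n (x ∷ xs)
  refillHead k x xs {n} {m} (_ ∷ fs , _ , es) none occupied emptied others fits = record
    { packing     = singleItem (size x) (other k) ∷ packing r
    ; sameBins    = cong₂ _∷_ (size-singleItem (size x) (other k)) (sameBins r)
    ; admissible  = Fits-singleItem (other k) fits ∷ proj₁ (admissible r) ,
                    (λ e → ⊥-elim (singleItem-nonempty (size x) (other k) e)) ,
                    proj₂ (admissible r)
    ; total-kind  = trans (cong₂ _+_ (count-singleItem-other (size x) k) tail-kind) (sym n≡0)
    ; total-other = begin
        count (other k) (singleItem (size x) (other k)) + total (other k) (packing r)
          ≡⟨ cong₂ _+_ (count-singleItem (size x) (other k)) (total-kind r) ⟩
        suc m
          ≡⟨ cong₂ _+_ other-in-x others ⟨
        count (other k) x + total (other k) xs ∎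
    ; cost≤       = +-mono-≤ (≤-reflexive used-unchanged) (cost≤ r)
    }
    where
    open ≡-Reasoning
    r = remove (other k) xs (fs , es) others
    tail-kind : total k (packing r) ≡ 0
    tail-kind = trans (subst (λ k′ → total k′ (packing r) ≡ total k′ xs) (other-involutive k) (total-other r))
                      none
    n≡0 : n ≡ 0
    n≡0 = trans (cong pred (sym occupied)) (trans (sym (count-dropItem k x)) (Empty⇒count≡0 k emptied))
    other-in-x : count (other k) x ≡ 0
    other-in-x = trans (sym (count-other-dropItem k x)) (Empty⇒count≡0 (other k) emptied)
    used-unchanged : usedSize (singleItem (size x) (other k)) ≡ usedSize x
    used-unchanged = trans (usedSize-singleItem (size x) (other k))
                           (sym (usedSize-occupied k (subst (0 <_) (sym occupied) z<s)))

Reduct-refl : ∀ {S k p} → Admissible S p → Reduct S k (total k p) p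
Reduct-refl {p = p} adm = record
  { packing = p ; sameBins = refl ; admissible = adm ; total-kind = refl ; total-other = refl ; cost≤ = ≤-refl }

Reduct-trans : ∀ {S k m n p} (r : Reduct S k m p) → Reduct S k n (packing r) → Reduct S k n p
Reduct-trans r r′ = record
  { packing     = packing r′
  ; sameBins    = trans (sameBins r′) (sameBins r)
  ; admissible  = admissible r′
  ; total-kind  = total-kind r′
  ; total-other = trans (total-other r′) (total-other r)
  ; cost≤       = ≤-trans (cost≤ r′) (cost≤ r)
  }

reduce : ∀ {S} k p {n t} → n ≤′ t → Admissible S p → total k p ≡ t → Reduct S k n p
reduce k p (≤′-reflexive refl) adm refl = Reduct-refl adm
reduce k p (≤′-step n≤′t)      adm eq   =
  Reduct-trans r (reduce k (packing r) n≤′t (admissible r) (total-kind r))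
  where r = remove k p adm eq

validPacking-fewerItems : ∀ {S σ s ℓ s′ ℓ′ p} → s′ ≤ s → ℓ′ ≤ ℓ → ValidPacking S σ s ℓ p →
  Σ Packing λ q → ValidPacking S σ s′ ℓ′ q × cost q ≤ cost p
validPacking-fewerItems {p = p} s′≤s ℓ′≤ℓ (onBins , fits , smalls , larges , emptyCond) =
  packing r₂ ,
  (trans (sameBins r₂) (trans (sameBins r₁) onBins) , proj₁ (admissible r₂) ,
   trans (total-other r₂) (total-kind r₁) , total-kind r₂ , proj₂ (admissible r₂)) ,
  ≤-trans (cost≤ r₂) (cost≤ r₁)
  where
  r₁ = reduce small p (≤⇒≤′ s′≤s) (fits , emptyCond) smalls
  r₂ = reduce large (packing r₁) (≤⇒≤′ ℓ′≤ℓ) (admissible r₁) (trans (total-other r₁) larges)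

candidates : BinSeq → ℕ → ℕ → List Packing
candidates []      s ℓ = [] ∷ []
candidates (b ∷ σ) s ℓ =
  cartesianProductWith _∷_ (cartesianProductWith (slot b) (upTo (suc s)) (upTo (suc ℓ))) (candidates σ s ℓ)

∈-candidates : ∀ {s ℓ} p → All (λ x → nSmall x ≤ s × nLarge x ≤ ℓ) p → p ∈ candidates (map size p) s ℓ
∈-candidates []               []                   = here refl
∈-candidates (slot b i j ∷ p) ((i≤s , j≤ℓ) ∷ bounds) =
  ∈-cartesianProductWith⁺ _∷_
    (∈-cartesianProductWith⁺ (slot b) (∈-upTo⁺ (s≤s i≤s)) (∈-upTo⁺ (s≤s j≤ℓ)))
    (∈-candidates p bounds)

summands≤sum : ∀ ns → All (_≤ sum ns) ns
summands≤sum []       = []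
summands≤sum (n ∷ ns) = m≤m+n n (sum ns) ∷ All.map (λ h → ≤-trans h (m≤n+m _ n)) (summands≤sum ns)

validPacking⇒∈candidates : ∀ {S σ s ℓ p} → ValidPacking S σ s ℓ p → p ∈ candidates σ s ℓ
validPacking⇒∈candidates {p = p} (refl , _ , refl , refl , _) =
  ∈-candidates p (All.zip (map⁻ (summands≤sum (map nSmall p)) , map⁻ (summands≤sum (map nLarge p))))

smallerThanItemsOf? : ∀ S x y → Dec (SmallerThanItemsOf S x y)
smallerThanItemsOf? S x y =
  ((0 <? nSmall y) →-dec (size x <? S)) ×-dec ((0 <? nLarge y) →-dec (size x <? Lsz S))

emptyCond? : ∀ S p → Dec (EmptyCond S p)
emptyCond? S []       = yes tt
emptyCond? S (x ∷ xs) = (empty? x →-dec all? (smallerThanItemsOf? S x) xs) ×-dec emptyCond? S xs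

validPacking? : ∀ S σ s ℓ p → Dec (ValidPacking S σ s ℓ p)
validPacking? S σ s ℓ p =
  ≡-dec _≟_ (map size p) σ ×-dec all? (λ x → _ ≤? size x) p ×-dec
  (sum (map nSmall p) ≟ s) ×-dec (sum (map nLarge p) ≟ ℓ) ×-dec emptyCond? S p

OPT-exists : ∀ {S σ s ℓ p} → ValidPacking S σ s ℓ p → Σ ℕ (IsOPT S σ s ℓ)
OPT-exists {S} {σ} {s} {ℓ} {p} valid = cost best , (best , best-valid , refl) , best-minimal
  where
  valids : List Packing
  valids = filter (validPacking? S σ s ℓ) (candidates σ s ℓ)
  best : Packing
  best = argmin cost p valids
  best-valid : ValidPacking S σ s ℓ best
  best-valid = argmin-all cost valid (all-filter (validPacking? S σ s ℓ) (candidates σ s ℓ))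
  best-minimal : ∀ q → ValidPacking S σ s ℓ q → cost best ≤ cost q
  best-minimal q valid-q = All.lookup (f[argmin]≤f[xs] p valids)
    (∈-filter⁺ (validPacking? S σ s ℓ) (validPacking⇒∈candidates valid-q) valid-q)

proposition2 : (S : ℕ) → 1 < S → (σ : BinSeq) → BinsInRange S σ →
    (s s' ℓ ℓ' : ℕ) → s' ≤ s → ℓ' ≤ ℓ →
    (c : ℕ) → IsOPT S σ s ℓ c →
    Σ ℕ (λ c' → IsOPT S σ s' ℓ' c' × c' ≤ c)
proposition2 S _ σ _ s s' ℓ ℓ' s'≤s ℓ'≤ℓ c ((p , valid , refl) , _)
  with q , valid-q , q≤p ← validPacking-fewerItems s'≤s ℓ'≤ℓ valid
  with c' , opt ← OPT-exists valid-q
  = c' , opt , ≤-trans (proj₂ opt q valid-q) q≤p
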